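{- Let $G$ be a connected cactus graph. For any $e_1\in E_{\mathsf{opp}}$ and any edge $e_2$ of $\mathsf{OS}(e_1)$, the edges $e_1$ and $e_2$ are not conflicting, i.e., there is no shortest path in $G$ containing both $e_1$ and $e_2$.
   Context: All graphs are finite, simple and undirected. A cactus graph is a graph in which every edge belongs to at most one cycle. For a vertex $v$ and a cycle $C$ containing $v$, $\mathsf{S}(v,C)$ is the set of vertices of $G$ reachable from $v$ without using any edge of $C$. For an edge $e$ of an odd cycle $C$, the opposite vertex $\mathsf{vopp}(e)$ is the unique vertex of $C$ equidistant (in $G$) from both endpoints of $e$, and the opposite subgraph is $\mathsf{OS}(e)=G[\mathsf{S}(\mathsf{vopp}(e),C)]$. $E_{\mathsf{opp}}$ is the set of edges $e$ lying in an odd cycle such that $\mathsf{vopp}(e)$ does not have degree $2$ in $G$. -}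

module Defs where

open import Data.Nat using (ℕ; zero; suc; _≤_; _<?_; _%_; _+_)
open import Data.Fin using (Fin; zero; suc; toℕ; fromℕ<)
open import Data.Bool using (Bool; true; false; T; if_then_else_)
open import Data.List using (List; map; allFin)
open import Data.Nat.ListAction using (sum)
open import Data.Product using (Σ; ∃; _×_; _,_)
open import Data.Sum using (_⊎_)
open import Relation.Nullary using (¬_; yes; no)
open import Relation.Binary.PropositionalEquality using (_≡_)
open import Function.Definitions using (Injective)

record Graph (n : ℕ) : Set where
  field
    adj        : Fin n → Fin n → Bool
    adj-sym    : ∀ u v → adj u v ≡ adj v u
    adj-irrefl : ∀ u → adj u u ≡ false
open Graph public

module _ {n : ℕ} (G : Graph n) where

  Adj : Fin n → Fin n → Set
  Adj u v = T (adj G u v)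

  deg : Fin n → ℕ
  deg v = sum (map (λ u → if adj G v u then 1 else 0) (allFin n))

  data Walk : Fin n → Fin n → Set where
    []  : ∀ {u} → Walk u u
    _∷_ : ∀ {u v w} → Adj u v → Walk v w → Walk u w

  len : ∀ {u v} → Walk u v → ℕ
  len []      = 0
  len (_ ∷ p) = suc (len p)

  data Uses : ∀ {u v} → Walk u v → Fin n → Fin n → Set where
    here-fwd : ∀ {u v w} (a : Adj u v) (p : Walk v w) → Uses (a ∷ p) u v
    here-bwd : ∀ {u v w} (a : Adj u v) (p : Walk v w) → Uses (a ∷ p) v u
    there    : ∀ {u v w x y} (a : Adj u v) {p : Walk v w} → Uses p x y → Uses (a ∷ p) x y

  -- a shortest walk from u to v (such a walk is automatically a path)
  IsShortest : ∀ {u v} → Walk u v → Set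
  IsShortest {u} {v} p = ∀ (q : Walk u v) → len p ≤ len q

  IsDist : Fin n → Fin n → ℕ → Set
  IsDist u v d = Σ (Walk u v) (λ p → len p ≡ d × IsShortest p)

  Connected : Set
  Connected = ∀ u v → Walk u v

next : ∀ {k} → Fin k → Fin k
next {suc m} i with suc (toℕ i) <? suc m
... | yes p = fromℕ< p
... | no _  = zero

record Cycle {n : ℕ} (G : Graph n) : Set where
  field
    size     : ℕ
    3≤size   : 3 ≤ size
    vert     : Fin size → Fin n
    inj      : Injective _≡_ _≡_ vert
    adjacent : ∀ i → Adj G (vert i) (vert (next i))
open Cycle public

module _ {n : ℕ} {G : Graph n} (C : Cycle G) where

  CycleEdge : Fin n → Fin n → Set
  CycleEdge x y = ∃ λ i → (vert C i ≡ x × vert C (next i) ≡ y)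
                        ⊎ (vert C i ≡ y × vert C (next i) ≡ x)

  OnCycle : Fin n → Set
  OnCycle v = ∃ λ i → vert C i ≡ v

  OddCycle : Set
  OddCycle = size C % 2 ≡ 1

  AvoidsC : ∀ {u v} → Walk G u v → Set
  AvoidsC p = ∀ a b → Uses G p a b → ¬ CycleEdge a b

  -- u ∈ S(v,C): reachable from v without using any edge of C
  InS : Fin n → Fin n → Set
  InS v u = Σ (Walk G v u) AvoidsC

-- cactus: every edge lies in at most one cycle (cycles compared as subgraphs,
-- i.e. by their edge sets)
Cactus : ∀ {n} → Graph n → Set
Cactus G = ∀ (C D : Cycle G) x y → CycleEdge C x y → CycleEdge D x y →
           ∀ a b → (CycleEdge C a b → CycleEdge D a b) × (CycleEdge D a b → CycleEdge C a b)

Equidistant : ∀ {n} → Graph n → Fin n → Fin n → Fin n → Set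
Equidistant G x y w = ∃ λ d → IsDist G x w d × IsDist G y w d

-- In a cactus, w is the only vertex of C in S(w,C): a shortest C-avoiding walk between two
-- distinct vertices of C is a path meeting C only at its ends, and together with an arc of C
-- it closes a second cycle sharing an edge of C without being C. So a walk from S(w,C) to an
-- endpoint of e₁ other than w passes through w. A shortest walk through w, however, cannot use
-- e₁ = xy: its part between w and e₁ would reach one endpoint through the other, although both
-- are at the same distance from w.
module Submission where

open import Defs
open import Data.Nat using (ℕ; zero; suc; _+_; _≤_; _<_; _<?_; _≤‴_; ≤‴-refl; ≤‴-step; z≤n; s≤s; NonZero; >-nonZero)
open import Data.Nat.Properties
open import Data.Nat.DivMod using (_mod_; m<n⇒m%n≡m)
open import Data.Nat.Induction using (<-wellFounded)
open import Induction.WellFounded using (Acc; acc)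
open import Data.Fin using (Fin; zero; suc; toℕ; fromℕ; inject₁) renaming (_≟_ to _≟ᶠ_)
open import Data.Fin.Properties using (toℕ-fromℕ<; toℕ-fromℕ; toℕ-inject₁; toℕ-injective; toℕ<n; any?)
open import Data.Fin.Relation.Unary.Top using (view; ‵fromℕ; ‵inject₁)
open import Data.Bool using (T)
open import Data.Empty using (⊥; ⊥-elim)
open import Data.Product using (∃; ∃₂; Σ; _×_; _,_; proj₁; proj₂)
open import Data.Sum using (_⊎_; inj₁; inj₂; [_,_]′; map₁)
open import Function using (_∘_)
open import Relation.Nullary using (¬_; Dec; yes; no; contradiction)
open import Relation.Nullary.Decidable using (_×-dec_; _⊎-dec_)
open import Relation.Binary.Definitions using (tri<; tri≈; tri>)
open import Relation.Binary.PropositionalEquality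

toℕ-next : ∀ {k} (i : Fin k) → suc (toℕ i) < k → toℕ (next i) ≡ suc (toℕ i)
toℕ-next {suc m} i lt with suc (toℕ i) <? suc m
... | yes lt′ = toℕ-fromℕ< lt′
... | no ¬lt  = contradiction lt ¬lt

next-fromℕ : ∀ m → next (fromℕ m) ≡ zero
next-fromℕ m with suc (toℕ (fromℕ m)) <? suc m
... | yes lt = contradiction (subst (λ k → suc k < suc m) (toℕ-fromℕ m) lt) (<-irrefl refl)
... | no _   = refl

next-inject₁ : ∀ {m} (j : Fin m) → next (inject₁ j) ≡ suc j
next-inject₁ {m} j = toℕ-injective (begin
  toℕ (next (inject₁ j))  ≡⟨ toℕ-next (inject₁ j) (s≤s (subst (_< m) (sym (toℕ-inject₁ j)) (toℕ<n j))) ⟩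
  suc (toℕ (inject₁ j))   ≡⟨ cong suc (toℕ-inject₁ j) ⟩
  suc (toℕ j)             ∎)
  where open ≡-Reasoning

module _ {n : ℕ} (G : Graph n) where

  Adj-sym : ∀ {u v} → Adj G u v → Adj G v u
  Adj-sym {u} {v} = subst T (adj-sym G u v)

  Adj-irrefl : ∀ {u v} → Adj G u v → u ≢ v
  Adj-irrefl {u} e refl = subst T (adj-irrefl G u) e

  infixr 5 _++_

  _++_ : ∀ {u v w} → Walk G u v → Walk G v w → Walk G u w
  []      ++ q = q
  (e ∷ p) ++ q = e ∷ (p ++ q)

  len-++ : ∀ {u v w} (p : Walk G u v) (q : Walk G v w) → len G (p ++ q) ≡ len G p + len G q
  len-++ []      q = refl
  len-++ (_ ∷ p) q = cong suc (len-++ p q)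

  len-pos : ∀ {u v} (p : Walk G u v) → u ≢ v → 0 < len G p
  len-pos []      u≢v = contradiction refl u≢v
  len-pos (_ ∷ _) _   = s≤s z≤n

  first-edge : ∀ {u v} (p : Walk G u v) → u ≢ v → ∃ λ u′ → Uses G p u u′
  first-edge []      u≢v = contradiction refl u≢v
  first-edge (e ∷ p) _   = _ , here-fwd e p

  reverse : ∀ {u v} → Walk G u v → Walk G v u
  reverse []      = []
  reverse (e ∷ p) = reverse p ++ (Adj-sym e ∷ [])

  len-reverse : ∀ {u v} (p : Walk G u v) → len G (reverse p) ≡ len G p
  len-reverse []      = refl
  len-reverse (e ∷ p) = begin
    len G (reverse p ++ (Adj-sym e ∷ []))  ≡⟨ len-++ (reverse p) _ ⟩
    len G (reverse p) + 1                  ≡⟨ +-comm _ 1 ⟩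
    suc (len G (reverse p))                ≡⟨ cong suc (len-reverse p) ⟩
    suc (len G p)                          ∎
    where open ≡-Reasoning

  uses-++⁻ : ∀ {u v w x y} (p : Walk G u v) {q : Walk G v w} →
             Uses G (p ++ q) x y → Uses G p x y ⊎ Uses G q x y
  uses-++⁻ []      use              = inj₂ use
  uses-++⁻ (e ∷ p) (here-fwd .e _)  = inj₁ (here-fwd e p)
  uses-++⁻ (e ∷ p) (here-bwd .e _)  = inj₁ (here-bwd e p)
  uses-++⁻ (e ∷ p) (there .e use)   = map₁ (there e) (uses-++⁻ p use)

  uses-++⁺ˡ : ∀ {u v w x y} {p : Walk G u v} (q : Walk G v w) → Uses G p x y → Uses G (p ++ q) x y
  uses-++⁺ˡ q (here-fwd e p) = here-fwd e (p ++ q)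
  uses-++⁺ˡ q (here-bwd e p) = here-bwd e (p ++ q)
  uses-++⁺ˡ q (there e use)  = there e (uses-++⁺ˡ q use)

  uses-++⁺ʳ : ∀ {u v w x y} (p : Walk G u v) {q : Walk G v w} → Uses G q x y → Uses G (p ++ q) x y
  uses-++⁺ʳ []      use = use
  uses-++⁺ʳ (e ∷ p) use = there e (uses-++⁺ʳ p use)

  uses-reverse⁺ : ∀ {u v x y} {p : Walk G u v} → Uses G p x y → Uses G (reverse p) x y
  uses-reverse⁺ (here-fwd e p) = uses-++⁺ʳ (reverse p) (here-bwd (Adj-sym e) [])
  uses-reverse⁺ (here-bwd e p) = uses-++⁺ʳ (reverse p) (here-fwd (Adj-sym e) [])
  uses-reverse⁺ (there e use)  = uses-++⁺ˡ _ (uses-reverse⁺ use)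

  uses-reverse⁻ : ∀ {u v x y} (p : Walk G u v) → Uses G (reverse p) x y → Uses G p x y
  uses-reverse⁻ []      ()
  uses-reverse⁻ (e ∷ p) use with uses-++⁻ (reverse p) use
  ... | inj₁ use′                      = there e (uses-reverse⁻ p use′)
  ... | inj₂ (here-fwd _ _)            = here-bwd e p
  ... | inj₂ (here-bwd _ _)            = here-fwd e p
  ... | inj₂ (there _ ())

  single-edge-or-long : ∀ {u v} (p : Walk G u v) → u ≢ v → Uses G p u v ⊎ 2 ≤ len G p
  single-edge-or-long []           u≢v = contradiction refl u≢v
  single-edge-or-long (e ∷ [])     _   = inj₁ (here-fwd e [])
  single-edge-or-long (_ ∷ (_ ∷ _)) _   = inj₂ (s≤s (s≤s z≤n))

  data Visits : ∀ {u v} → Walk G u v → Fin n → Set where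
    start : ∀ {u v} {p : Walk G u v} → Visits p u
    later : ∀ {u v w z} {e : Adj G u v} {p : Walk G v w} → Visits p z → Visits (e ∷ p) z

  visits-end : ∀ {u v} (p : Walk G u v) → Visits p v
  visits-end []      = start
  visits-end (_ ∷ p) = later (visits-end p)

  visits? : ∀ {u v} (p : Walk G u v) z → Dec (Visits p z)
  visits? {u} p z with z ≟ᶠ u
  visits? p       z | yes refl = yes start
  visits? []      z | no z≢u   = no λ { start → z≢u refl }
  visits? (e ∷ p) z | no z≢u with visits? p z
  ... | yes v = yes (later v)
  ... | no ¬v = no λ { start → z≢u refl ; (later v) → ¬v v }

  visits-++⁻ : ∀ {u v w z} (p : Walk G u v) {q : Walk G v w} → Visits (p ++ q) z → Visits p z ⊎ Visits q z
  visits-++⁻ []      vz        = inj₂ vz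
  visits-++⁻ (e ∷ p) start     = inj₁ start
  visits-++⁻ (e ∷ p) (later v) = map₁ later (visits-++⁻ p v)

  visits-split : ∀ {u v z} {p : Walk G u v} → Visits p z → ∃₂ λ (q : Walk G u z) (r : Walk G z v) → q ++ r ≡ p
  visits-split {p = p} start = [] , p , refl
  visits-split {p = e ∷ _} (later v) with visits-split v
  ... | q , r , refl = e ∷ q , r , refl

  uses-visits : ∀ {u v x y} {p : Walk G u v} → Uses G p x y → Visits p x × Visits p y
  uses-visits (here-fwd _ _) = start , later start
  uses-visits (here-bwd _ _) = later start , start
  uses-visits (there _ use)  = let vx , vy = uses-visits use in later vx , later vy

  data IsPath : ∀ {u v} → Walk G u v → Set where
    []  : ∀ {u} → IsPath {u} {u} []
    _∷_ : ∀ {u v w} {e : Adj G u v} {p : Walk G v w} → ¬ Visits p u → IsPath p → IsPath (e ∷ p)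

  isPath-++ : ∀ {u v w} {p : Walk G u v} {q : Walk G v w} → IsPath p → IsPath q →
              (∀ {z} → Visits p z → Visits q z → z ≡ v) → IsPath (p ++ q)
  isPath-++ []                               q-path _    = q-path
  isPath-++ {p = _ ∷ p} {q} (u∉p ∷ p-path) q-path meet =
    u∉p++q ∷ isPath-++ p-path q-path (meet ∘ later)
    where
    u∉p++q : ¬ Visits (p ++ q) _
    u∉p++q v with visits-++⁻ p v
    ... | inj₁ vp = u∉p vp
    ... | inj₂ vq = u∉p (subst (Visits p) (sym (meet start vq)) (visits-end p))

  Shortcut : ∀ {u v} → Walk G u v → Set
  Shortcut {u} {v} p = Σ (Walk G u v) λ q → len G q < len G p × (∀ {x y} → Uses G q x y → Uses G p x y)

  isPath-or-shortcut : ∀ {u v} (p : Walk G u v) → IsPath p ⊎ Shortcut p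
  isPath-or-shortcut []              = inj₁ []
  isPath-or-shortcut {u} (e ∷ p) with isPath-or-shortcut p | visits? p u
  ... | inj₂ (q , q<p , q⊆p) | _       = inj₂ (e ∷ q , s≤s q<p , e∷q⊆e∷p)
    where
    e∷q⊆e∷p : ∀ {x y} → Uses G (e ∷ q) x y → Uses G (e ∷ p) x y
    e∷q⊆e∷p (here-fwd _ _) = here-fwd e p
    e∷q⊆e∷p (here-bwd _ _) = here-bwd e p
    e∷q⊆e∷p (there _ use)  = there e (q⊆p use)
  ... | inj₁ p-path | no u∉p  = inj₁ (u∉p ∷ p-path)
  ... | inj₁ _      | yes u∈p with visits-split u∈p
  ...   | q , r , refl = inj₂ (r , s≤s (subst (len G r ≤_) (sym (len-++ q r)) (m≤n+m _ _)) , there e ∘ uses-++⁺ʳ q)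

  shortest-++ˡ : ∀ {u v w} (p : Walk G u v) (q : Walk G v w) → IsShortest G (p ++ q) → IsShortest G p
  shortest-++ˡ p q p++q-min p′ =
    +-cancelʳ-≤ (len G q) _ _ (subst₂ _≤_ (len-++ p q) (len-++ p′ q) (p++q-min (p′ ++ q)))

  shortest-++ʳ : ∀ {u v w} (p : Walk G u v) (q : Walk G v w) → IsShortest G (p ++ q) → IsShortest G q
  shortest-++ʳ p q p++q-min q′ =
    +-cancelˡ-≤ (len G p) _ _ (subst₂ _≤_ (len-++ p q) (len-++ p q′) (p++q-min (p ++ q′)))

  shortest-reverse : ∀ {u v} {p : Walk G u v} → IsShortest G p → IsShortest G (reverse p)
  shortest-reverse {p = p} p-min q =
    subst₂ _≤_ (sym (len-reverse p)) (len-reverse q) (p-min (reverse q))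

  vertex : ∀ {u v} (p : Walk G u v) → Fin (suc (len G p)) → Fin n
  vertex {u} _       zero    = u
  vertex     (_ ∷ p) (suc i) = vertex p i

  vertex-last : ∀ {u v} (p : Walk G u v) → vertex p (fromℕ (len G p)) ≡ v
  vertex-last []      = refl
  vertex-last (_ ∷ p) = vertex-last p

  vertex-step : ∀ {u v} (p : Walk G u v) (j : Fin (len G p)) → Adj G (vertex p (inject₁ j)) (vertex p (suc j))
  vertex-step (e ∷ _) zero    = e
  vertex-step (_ ∷ p) (suc j) = vertex-step p j

  vertex-visits : ∀ {u v} (p : Walk G u v) i → Visits p (vertex p i)
  vertex-visits _       zero    = start
  vertex-visits (_ ∷ p) (suc i) = later (vertex-visits p i)

  vertex-injective : ∀ {u v} {p : Walk G u v} → IsPath p → ∀ {i j} → vertex p i ≡ vertex p j → i ≡ j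
  vertex-injective _                       {zero}  {zero}  _  = refl
  vertex-injective {p = _ ∷ p} (u∉p ∷ _)   {zero}  {suc j} eq = contradiction (subst (Visits p) (sym eq) (vertex-visits p j)) u∉p
  vertex-injective {p = _ ∷ p} (u∉p ∷ _)   {suc i} {zero}  eq = contradiction (subst (Visits p) eq (vertex-visits p i)) u∉p
  vertex-injective (_ ∷ p-path)            {suc i} {suc j} eq = cong suc (vertex-injective p-path eq)

  vertex-uses : ∀ {u v x y} {p : Walk G u v} → Uses G p x y →
                ∃ λ j → (vertex p (inject₁ j) ≡ x × vertex p (suc j) ≡ y) ⊎ (vertex p (inject₁ j) ≡ y × vertex p (suc j) ≡ x)
  vertex-uses (here-fwd _ _) = zero , inj₁ (refl , refl)
  vertex-uses (here-bwd _ _) = zero , inj₂ (refl , refl)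
  vertex-uses (there _ use)  = let j , ends = vertex-uses use in suc j , ends

  module _ {u v} (p : Walk G u v) (p-path : IsPath p) (2≤len : 2 ≤ len G p) (closing : Adj G v u) where

    pathCycle : Cycle G
    pathCycle = record
      { size     = suc (len G p)
      ; 3≤size   = s≤s 2≤len
      ; vert     = vertex p
      ; inj      = vertex-injective p-path
      ; adjacent = adjacent′
      }
      where
      adjacent′ : ∀ i → Adj G (vertex p i) (vertex p (next i))
      adjacent′ i with view i
      ... | ‵fromℕ     = subst₂ (Adj G) (sym (vertex-last p)) (cong (vertex p) (sym (next-fromℕ _))) closing
      ... | ‵inject₁ j = subst (Adj G _) (cong (vertex p) (sym (next-inject₁ j))) (vertex-step p j)

    pathCycle-closing : CycleEdge pathCycle v u
    pathCycle-closing = fromℕ (len G p) , inj₁ (vertex-last p , cong (vertex p) (next-fromℕ _))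

    pathCycle-uses : ∀ {x y} → Uses G p x y → CycleEdge pathCycle x y
    pathCycle-uses use with vertex-uses use
    ... | j , inj₁ (ex , ey) = inject₁ j , inj₁ (ex , trans (cong (vertex p) (next-inject₁ j)) ey)
    ... | j , inj₂ (ey , ex) = inject₁ j , inj₂ (ey , trans (cong (vertex p) (next-inject₁ j)) ex)

  module _ (C : Cycle G) where

    cycleEdge-sym : ∀ {x y} → CycleEdge C x y → CycleEdge C y x
    cycleEdge-sym (i , inj₁ ends) = i , inj₂ ends
    cycleEdge-sym (i , inj₂ ends) = i , inj₁ ends

    cycleEdge-adj : ∀ {x y} → CycleEdge C x y → Adj G x y
    cycleEdge-adj (i , inj₁ (refl , refl)) = adjacent C i
    cycleEdge-adj (i , inj₂ (refl , refl)) = Adj-sym (adjacent C i)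

    cycleEdge-onCycle : ∀ {x y} → CycleEdge C x y → OnCycle C x × OnCycle C y
    cycleEdge-onCycle (i , inj₁ (ex , ey)) = (i , ex) , (next i , ey)
    cycleEdge-onCycle (i , inj₂ (ey , ex)) = (next i , ex) , (i , ey)

    cycleEdge? : ∀ x y → Dec (CycleEdge C x y)
    cycleEdge? x y = any? λ i → ((vert C i ≟ᶠ x) ×-dec (vert C (next i) ≟ᶠ y))
                           ⊎-dec ((vert C i ≟ᶠ y) ×-dec (vert C (next i) ≟ᶠ x))

    InS-extend : ∀ {w u u′} → InS C w u → Adj G u u′ → ¬ CycleEdge C u u′ → InS C w u′
    InS-extend (q , q-avoids) e e∉C = q ++ (e ∷ []) , λ a b use → [ q-avoids a b , edge-avoids ]′ (uses-++⁻ q use)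
      where
      edge-avoids : ∀ {a b} → Uses G (e ∷ []) a b → ¬ CycleEdge C a b
      edge-avoids (here-fwd _ _) = e∉C
      edge-avoids (here-bwd _ _) = e∉C ∘ cycleEdge-sym
      edge-avoids (there _ ())

    leave-S-through-root : ∀ {w} → (∀ {z} → OnCycle C z → InS C w z → z ≡ w) →
                           ∀ {u v s t} {p : Walk G u v} → Visits p s → Visits p t → InS C w s → ¬ InS C w t → Visits p w
    leave-S-through-root only start start s∈S t∉S = contradiction s∈S t∉S
    leave-S-through-root only (later vs) (later vt) s∈S t∉S = later (leave-S-through-root only vs vt s∈S t∉S)
    leave-S-through-root {w} only {u} {p = e ∷ p} start (later vt) u∈S t∉S with u ≟ᶠ w | cycleEdge? u _
    ... | yes refl | _       = start
    ... | no u≢w   | yes e∈C = contradiction (only (proj₁ (cycleEdge-onCycle e∈C)) u∈S) u≢w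
    ... | no _     | no e∉C  = later (leave-S-through-root only start vt (InS-extend u∈S e e∉C) t∉S)
    leave-S-through-root {w} only {u} {p = _∷_ {v = u′} e p} (later vs) start s∈S u∉S with u′ ≟ᶠ w | cycleEdge? u u′
    ... | yes refl | _       = later start
    ... | no u′≢w  | yes e∈C = later (leave-S-through-root only vs start s∈S
                                 (u′≢w ∘ only (proj₂ (cycleEdge-onCycle e∈C))))
    ... | no _     | no e∉C  = later (leave-S-through-root only vs start s∈S
                                 (λ u′∈S → u∉S (InS-extend u′∈S (Adj-sym e) (e∉C ∘ cycleEdge-sym))))

    Bypass : ∀ {s t} → Walk G s t → Set
    Bypass {s} {t} P = AvoidsC C P × OnCycle C s × OnCycle C t × s ≢ t

    NoBypassShorterThan : ℕ → Set
    NoBypassShorterThan ℓ = ∀ {s t} (P : Walk G s t) → Bypass P → len G P < ℓ → ⊥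

    bypass-reverse : ∀ {s t} (P : Walk G s t) → Bypass P → Bypass (reverse P)
    bypass-reverse P (P-avoids , s∈C , t∈C , s≢t) =
      (λ a b → P-avoids a b ∘ uses-reverse⁻ P) , t∈C , s∈C , s≢t ∘ sym

    minimal-bypass-isPath : ∀ {s t} {P : Walk G s t} → Bypass P → NoBypassShorterThan (len G P) → IsPath P
    minimal-bypass-isPath {P = P} (P-avoids , ends) none with isPath-or-shortcut P
    ... | inj₁ P-path          = P-path
    ... | inj₂ (Q , Q<P , Q⊆P) = ⊥-elim (none Q ((λ a b → P-avoids a b ∘ Q⊆P) , ends) Q<P)

    minimal-bypass-meets-C-at-ends : ∀ {s t z} {P : Walk G s t} → Bypass P → NoBypassShorterThan (len G P) →
                                     Visits P z → OnCycle C z → z ≡ s ⊎ z ≡ t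
    minimal-bypass-meets-C-at-ends {s} {t} {z} (P-avoids , s∈C , _ , _) none vz z∈C with z ≟ᶠ s | z ≟ᶠ t
    ... | yes z≡s | _       = inj₁ z≡s
    ... | no _    | yes z≡t = inj₂ z≡t
    ... | no z≢s  | no z≢t with visits-split vz
    ...   | Q , R , refl =
      ⊥-elim (none Q ((λ a b → P-avoids a b ∘ uses-++⁺ˡ R) , s∈C , z∈C , z≢s ∘ sym)
                     (subst (len G Q <_) (sym (len-++ Q R)) (m<m+n _ (len-pos R z≢t))))

    private instance
      size-nonZero : NonZero (size C)
      size-nonZero = >-nonZero (≤-trans (s≤s z≤n) (3≤size C))

    vertℕ : ℕ → Fin n
    vertℕ m = vert C (m mod size C)

    toℕ-mod : ∀ {m} → m < size C → toℕ (m mod size C) ≡ m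
    toℕ-mod m<k = trans (toℕ-fromℕ< _) (m<n⇒m%n≡m m<k)

    vertℕ-injective : ∀ {m m′} → m < size C → m′ < size C → vertℕ m ≡ vertℕ m′ → m ≡ m′
    vertℕ-injective m<k m′<k eq = trans (sym (toℕ-mod m<k)) (trans (cong toℕ (inj C eq)) (toℕ-mod m′<k))

    vertℕ-edge : ∀ {m} → suc m < size C → CycleEdge C (vertℕ m) (vertℕ (suc m))
    vertℕ-edge {m} sm<k = m mod size C , inj₁ (refl , cong (vert C) (toℕ-injective (begin
      toℕ (next (m mod size C))  ≡⟨ toℕ-next _ (subst (λ i → suc i < size C) (sym (toℕ-mod m<k)) sm<k) ⟩
      suc (toℕ (m mod size C))   ≡⟨ cong suc (toℕ-mod m<k) ⟩
      suc m                      ≡⟨ toℕ-mod sm<k ⟨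
      toℕ (suc m mod size C)     ∎)))
      where
      open ≡-Reasoning
      m<k = <-trans (n<1+n m) sm<k

    vertℕ-onCycle : ∀ m → OnCycle C (vertℕ m)
    vertℕ-onCycle m = m mod size C , refl

    onCycle-vertℕ : ∀ {z} → OnCycle C z → ∃ λ m → m < size C × vertℕ m ≡ z
    onCycle-vertℕ (i , refl) = toℕ i , toℕ<n i , cong (vert C) (toℕ-injective (toℕ-mod (toℕ<n i)))

    arc : ∀ {i j} → i ≤‴ j → j < size C → Walk G (vertℕ i) (vertℕ j)
    arc ≤‴-refl          _   = []
    arc (≤‴-step si≤j) j<k = cycleEdge-adj (vertℕ-edge (≤-<-trans (≤‴⇒≤ si≤j) j<k)) ∷ arc si≤j j<k

    arc-visits : ∀ {i j z} (i≤j : i ≤‴ j) (j<k : j < size C) → Visits (arc i≤j j<k) z →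
                 ∃ λ m → i ≤ m × m ≤ j × vertℕ m ≡ z
    arc-visits ≤‴-refl        _   start     = _ , ≤-refl , ≤-refl , refl
    arc-visits (≤‴-step si≤j) _   start     = _ , ≤-refl , ≤-trans (n≤1+n _) (≤‴⇒≤ si≤j) , refl
    arc-visits (≤‴-step si≤j) j<k (later v) =
      let m , si≤m , m≤j , eq = arc-visits si≤j j<k v in m , ≤-trans (n≤1+n _) si≤m , m≤j , eq

    arc-isPath : ∀ {i j} (i≤j : i ≤‴ j) (j<k : j < size C) → IsPath (arc i≤j j<k)
    arc-isPath ≤‴-refl          _   = []
    arc-isPath {i} (≤‴-step si≤j) j<k = i∉rest ∷ arc-isPath si≤j j<k
      where
      i∉rest : ¬ Visits (arc si≤j j<k) (vertℕ i)
      i∉rest v with arc-visits si≤j j<k v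
      ... | m , i<m , m≤j , eq = <-irrefl (sym (vertℕ-injective m<k (<-trans i<m m<k) eq)) i<m
        where m<k = ≤-<-trans m≤j j<k

    -- D is P followed by the arc of C from j up to i, closed by the C-edge from i to i+1.
    descending-minimal-bypass : Cactus G → ∀ {i j} → j ≤‴ i → suc i < size C →
                                (P : Walk G (vertℕ (suc i)) (vertℕ j)) → Bypass P → NoBypassShorterThan (len G P) → ⊥
    descending-minimal-bypass cactus {i} {j} j≤i si<k P P-bypass@(P-avoids , _ , _ , s≢t) none =
      P-avoids _ _ P-first (proj₂ (cactus C D _ _ (vertℕ-edge si<k) (pathCycle-closing Q Q-path Q-long closing) _ _)
                                  (pathCycle-uses Q Q-path Q-long closing (uses-++⁺ˡ A P-first)))
      where
      i<k = <-trans (n<1+n i) si<k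
      A = arc j≤i i<k
      Q = P ++ A
      closing = cycleEdge-adj (vertℕ-edge si<k)

      meet : ∀ {z} → Visits P z → Visits A z → z ≡ vertℕ j
      meet vP vA with arc-visits j≤i i<k vA
      ... | m , _ , m≤i , refl with minimal-bypass-meets-C-at-ends P-bypass none vP (vertℕ-onCycle m)
      ...   | inj₁ m≡si = contradiction (vertℕ-injective (≤-<-trans m≤i i<k) si<k m≡si) (<⇒≢ (s≤s m≤i))
      ...   | inj₂ m≡j  = m≡j

      Q-path : IsPath Q
      Q-path = isPath-++ (minimal-bypass-isPath P-bypass none) (arc-isPath j≤i i<k) meet

      Q-long : 2 ≤ len G Q
      Q-long = subst (2 ≤_) (sym (len-++ P A)) (long j≤i P-avoids s≢t)
        where
        long : ∀ {j} (j≤i : j ≤‴ i) {P : Walk G (vertℕ (suc i)) (vertℕ j)} → AvoidsC C P →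
               vertℕ (suc i) ≢ vertℕ j → 2 ≤ len G P + len G (arc j≤i i<k)
        long j≤i {P} P-avoids s≢t with single-edge-or-long P s≢t | j≤i
        ... | inj₂ 2≤P | _          = ≤-trans 2≤P (m≤m+n _ _)
        ... | inj₁ use | ≤‴-refl    = ⊥-elim (P-avoids _ _ use (cycleEdge-sym (vertℕ-edge si<k)))
        ... | inj₁ use | ≤‴-step _  = +-mono-≤ (len-pos P s≢t) (s≤s z≤n)

      D = pathCycle Q Q-path Q-long closing

      P-first = proj₂ (first-edge P s≢t)

    minimal-bypass : Cactus G → ∀ {s t} (P : Walk G s t) → Bypass P → NoBypassShorterThan (len G P) → ⊥
    minimal-bypass cactus P P-bypass@(_ , s∈C , t∈C , s≢t) none
      with onCycle-vertℕ s∈C | onCycle-vertℕ t∈C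
    ... | i , i<k , refl | j , j<k , refl with <-cmp i j
    ... | tri≈ _ refl _ = s≢t refl
    ... | tri> _ _ (s≤s j≤i) = descending-minimal-bypass cactus (≤⇒≤‴ j≤i) i<k P P-bypass none
    ... | tri< (s≤s i≤j) _ _ =
      descending-minimal-bypass cactus (≤⇒≤‴ i≤j) j<k (reverse P) (bypass-reverse P P-bypass)
        (subst NoBypassShorterThan (sym (len-reverse P)) none)

    no-bypass : Cactus G → ∀ {s t} (P : Walk G s t) → ¬ Bypass P
    no-bypass cactus P = go P (<-wellFounded (len G P))
      where
      go : ∀ {s t} (P : Walk G s t) → Acc _<_ (len G P) → ¬ Bypass P
      go P (acc shorter) P-bypass = minimal-bypass cactus P P-bypass (λ Q Q-bypass Q<P → go Q (shorter Q<P) Q-bypass)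

    cactus-S∩C : Cactus G → ∀ {w z} → OnCycle C w → OnCycle C z → InS C w z → z ≡ w
    cactus-S∩C cactus {w} {z} w∈C z∈C (P , P-avoids) with z ≟ᶠ w
    ... | yes z≡w = z≡w
    ... | no z≢w  = ⊥-elim (no-bypass cactus P (P-avoids , w∈C , z∈C , z≢w ∘ sym))

  level-first-step-not-shortest : ∀ {x y w d} (e : Adj G x y) (q : Walk G y w) →
                                  IsDist G x w d → IsDist G y w d → ¬ IsShortest G (e ∷ q)
  level-first-step-not-shortest e q (px , px≡d , _) (py , py≡d , py-min) e∷q-min = <-irrefl refl (begin-strict
    _        ≡⟨ py≡d ⟨
    len G py ≤⟨ py-min q ⟩
    len G q  <⟨ e∷q-min px ⟩
    len G px ≡⟨ px≡d ⟩
    _        ∎)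
    where open ≤-Reasoning

  shortest-to-root-avoids-level-edge : ∀ {u w x y d} {p : Walk G u w} → IsShortest G p →
                                       IsDist G x w d → IsDist G y w d → ¬ Uses G p x y
  shortest-to-root-avoids-level-edge p-min dx dy (here-fwd e q) = level-first-step-not-shortest e q dx dy p-min
  shortest-to-root-avoids-level-edge p-min dx dy (here-bwd e q) = level-first-step-not-shortest e q dy dx p-min
  shortest-to-root-avoids-level-edge p-min dx dy (there e use) =
    shortest-to-root-avoids-level-edge (shortest-++ʳ (e ∷ []) _ p-min) dx dy use

  shortest-through-root-avoids-level-edge : ∀ {u v w x y d} {p : Walk G u v} → IsShortest G p → Visits p w →
                                            IsDist G x w d → IsDist G y w d → ¬ Uses G p x y
  shortest-through-root-avoids-level-edge p-min vw dx dy use with visits-split vw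
  ... | q , r , refl with uses-++⁻ q use
  ...   | inj₁ use-q = shortest-to-root-avoids-level-edge (shortest-++ˡ q r p-min) dx dy use-q
  ...   | inj₂ use-r = shortest-to-root-avoids-level-edge (shortest-reverse (shortest-++ʳ q r p-min)) dx dy
                         (uses-reverse⁺ use-r)

lemma14 : ∀ {n : ℕ} (G : Graph n) → Connected G → Cactus G →
          (C : Cycle G) → OddCycle C →
          (x y : Fin n) → CycleEdge C x y →
          (w : Fin n) → OnCycle C w → Equidistant G x y w → deg G w ≢ 2 →
          (a b : Fin n) → Adj G a b → InS C w a → InS C w b →
          ∀ {u v} (p : Walk G u v) → IsShortest G p →
          ¬ (Uses G p x y × Uses G p a b)
lemma14 G _ cactus C _ x y xy∈C w w∈C (d , dx , dy) _ a b _ a∈S _ p p-min (uses-xy , uses-ab) =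
  shortest-through-root-avoids-level-edge G p-min p-visits-w dx dy uses-xy
  where
  only-w : ∀ {z} → OnCycle C z → InS C w z → z ≡ w
  only-w = cactus-S∩C G C cactus w∈C

  visited-outside-S : ∃ λ t → Visits G p t × ¬ InS C w t
  visited-outside-S with x ≟ᶠ w
  ... | no x≢w   = x , proj₁ (uses-visits G uses-xy) , x≢w ∘ only-w (proj₁ (cycleEdge-onCycle G C xy∈C))
  ... | yes refl = y , proj₂ (uses-visits G uses-xy) ,
                   Adj-irrefl G (cycleEdge-adj G C xy∈C) ∘ sym ∘ only-w (proj₂ (cycleEdge-onCycle G C xy∈C))

  p-visits-w : Visits G p w
  p-visits-w = let t , t-visited , t∉S = visited-outside-S in
    leave-S-through-root G C only-w (proj₁ (uses-visits G uses-ab)) t-visited a∈S t∉S
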